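{- Let $(\Sigma,C)$ be a monoidal theory and consider, in $\mathbf{Hyp}_{\Sigma,C}$, DPOI rules $L_1\leftarrow K_1\to R_1$, $L_2\leftarrow K_2\to R_2$ and a critical pair $(H_1\leftarrow J)\Leftarrow(S\leftarrow J)\Rightarrow(H_2\leftarrow J)$ for them. If both $K_1$ and $K_2$ are discrete hypergraphs (have no hyperedges), then the interface $J$ is discrete.
   Context: $\mathbf{Hyp}_{\Sigma,C}$: category of finite directed hypergraphs with nodes labelled in a finite set $C$ and hyperedges labelled in a signature $\Sigma$ of operations $o\colon w\to v$ ($w,v\in C^{\star}$), each hyperedge having ordered source and target lists whose labels form $w$ and $v$ respectively, with label-preserving homomorphisms. A DPOI rule is a span $L\leftarrow K\to R$. A DPOI rewriting step $(S\leftarrow J)\Rightarrow(H\leftarrow J)$ with rule $L\leftarrow K\to R$ consists of a match $f\colon L\to S$, an object $C'$ with $K\to C'$, $C'\to S$, $C'\to H$, $R\to H$ and $J\to C'$ such that the squares $K,L,C',S$ and $K,R,C',H$ are pushouts and the interface maps $J\to S$, $J\to H$ factor through $J\to C'$. A critical pair consists of two such steps from the same $S\leftarrow J$, with matches $f_i\colon L_i\to S$ and pushout complements $C_i$, such that $[f_1,f_2]\colon L_1+L_2\to S$ is an epimorphism and the square formed by $J\to C_1\to S$ and $J\to C_2\to S$ is a pullback. -}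

module Defs where

open import Data.Nat using (ℕ; _+_)
open import Data.Fin using (Fin; splitAt; _↑ˡ_; _↑ʳ_)
open import Data.Fin.Properties using (splitAt-↑ˡ; splitAt-↑ʳ)
open import Data.List using (List; map)
open import Data.List.Properties using (map-∘; map-cong)
open import Data.Sum using (_⊎_; inj₁; inj₂; [_,_]′)
open import Data.Product using (Σ; _×_; _,_)
open import Data.Empty using (⊥)
open import Function using (_∘_)
open import Relation.Binary.PropositionalEquality
  using (_≡_; refl; sym; trans; cong)

record Signature (nC : ℕ) : Set₁ where
  field
    Op  : Set
    dom : Op → List (Fin nC)
    cod : Op → List (Fin nC)

module HypCat {nC : ℕ} (Sig : Signature nC) where
  open Signature Sig

  C : Set
  C = Fin nC

  record Hyp : Set where
    field
      nV    : ℕ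
      nE    : ℕ
      labV  : Fin nV → C
      labE  : Fin nE → Op
      src   : Fin nE → List (Fin nV)
      tgt   : Fin nE → List (Fin nV)
      src-ok : ∀ e → map labV (src e) ≡ dom (labE e)
      tgt-ok : ∀ e → map labV (tgt e) ≡ cod (labE e)
  open Hyp public

  record _⇒_ (A B : Hyp) : Set where
    field
      fV    : Fin (nV A) → Fin (nV B)
      fE    : Fin (nE A) → Fin (nE B)
      presV : ∀ x → labV B (fV x) ≡ labV A x
      presE : ∀ e → labE B (fE e) ≡ labE A e
      presS : ∀ e → src B (fE e) ≡ map fV (src A e)
      presT : ∀ e → tgt B (fE e) ≡ map fV (tgt A e)
  open _⇒_ public

  infixr 9 _∘ₕ_
  _∘ₕ_ : ∀ {A B D} → B ⇒ D → A ⇒ B → A ⇒ D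
  _∘ₕ_ {A} {B} {D} g f = record
    { fV = fV g ∘ fV f
    ; fE = fE g ∘ fE f
    ; presV = λ x → trans (presV g (fV f x)) (presV f x)
    ; presE = λ e → trans (presE g (fE f e)) (presE f e)
    ; presS = λ e → trans (presS g (fE f e))
                     (trans (cong (map (fV g)) (presS f e)) (sym (map-∘ (src A e))))
    ; presT = λ e → trans (presT g (fE f e))
                     (trans (cong (map (fV g)) (presT f e)) (sym (map-∘ (tgt A e))))
    }

  infix 4 _≈_
  _≈_ : ∀ {A B} → A ⇒ B → A ⇒ B → Set
  f ≈ g = (∀ x → fV f x ≡ fV g x) × (∀ e → fE f e ≡ fE g e)

  Discrete : Hyp → Set
  Discrete A = nE A ≡ 0

  IsEpi : ∀ {A B} → A ⇒ B → Set
  IsEpi {A} {B} f = ∀ {X} (g h : B ⇒ X) → g ∘ₕ f ≈ h ∘ₕ f → g ≈ h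

  IsPushout : ∀ {K L D S} (a : K ⇒ L) (b : K ⇒ D) (p : L ⇒ S) (q : D ⇒ S) → Set
  IsPushout {K} {L} {D} {S} a b p q =
    (p ∘ₕ a ≈ q ∘ₕ b) ×
    (∀ {X} (p' : L ⇒ X) (q' : D ⇒ X) → p' ∘ₕ a ≈ q' ∘ₕ b →
       Σ (S ⇒ X) λ u → (u ∘ₕ p ≈ p') × (u ∘ₕ q ≈ q') ×
         (∀ (u' : S ⇒ X) → u' ∘ₕ p ≈ p' → u' ∘ₕ q ≈ q' → u' ≈ u))

  IsPullback : ∀ {J A B S} (a : J ⇒ A) (b : J ⇒ B) (p : A ⇒ S) (q : B ⇒ S) → Set
  IsPullback {J} {A} {B} {S} a b p q =
    (p ∘ₕ a ≈ q ∘ₕ b) ×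
    (∀ {X} (a' : X ⇒ A) (b' : X ⇒ B) → p ∘ₕ a' ≈ q ∘ₕ b' →
       Σ (X ⇒ J) λ u → (a ∘ₕ u ≈ a') × (b ∘ₕ u ≈ b') ×
         (∀ (u' : X ⇒ J) → a ∘ₕ u' ≈ a' → b ∘ₕ u' ≈ b' → u' ≈ u))

  module _ (A B : Hyp) where
    private
      labV⊎ : Fin (nV A) ⊎ Fin (nV B) → C
      labV⊎ = [ labV A , labV B ]′
      labE⊎ : Fin (nE A) ⊎ Fin (nE B) → Op
      labE⊎ = [ labE A , labE B ]′
      labV+ : Fin (nV A + nV B) → C
      labV+ = labV⊎ ∘ splitAt (nV A)
      inl : Fin (nV A) → Fin (nV A + nV B)
      inl x = x ↑ˡ nV B
      inr : Fin (nV B) → Fin (nV A + nV B)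
      inr x = nV A ↑ʳ x
      src⊎ tgt⊎ : Fin (nE A) ⊎ Fin (nE B) → List (Fin (nV A + nV B))
      src⊎ = [ (λ e → map inl (src A e)) , (λ e → map inr (src B e)) ]′
      tgt⊎ = [ (λ e → map inl (tgt A e)) , (λ e → map inr (tgt B e)) ]′
      labl : ∀ xs → map labV+ (map inl xs) ≡ map (labV A) xs
      labl xs = trans (sym (map-∘ xs))
                  (map-cong (λ x → cong labV⊎ (splitAt-↑ˡ (nV A) x (nV B))) xs)
      labr : ∀ xs → map labV+ (map inr xs) ≡ map (labV B) xs
      labr xs = trans (sym (map-∘ xs))
                  (map-cong (λ x → cong labV⊎ (splitAt-↑ʳ (nV A) (nV B) x)) xs)
      src⊎-ok : ∀ e → map labV+ (src⊎ e) ≡ dom (labE⊎ e)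
      src⊎-ok (inj₁ e) = trans (labl (src A e)) (src-ok A e)
      src⊎-ok (inj₂ e) = trans (labr (src B e)) (src-ok B e)
      tgt⊎-ok : ∀ e → map labV+ (tgt⊎ e) ≡ cod (labE⊎ e)
      tgt⊎-ok (inj₁ e) = trans (labl (tgt A e)) (tgt-ok A e)
      tgt⊎-ok (inj₂ e) = trans (labr (tgt B e)) (tgt-ok B e)

    _⊕_ : Hyp
    _⊕_ = record
      { nV = nV A + nV B
      ; nE = nE A + nE B
      ; labV = labV+
      ; labE = labE⊎ ∘ splitAt (nE A)
      ; src = src⊎ ∘ splitAt (nE A)
      ; tgt = tgt⊎ ∘ splitAt (nE A)
      ; src-ok = src⊎-ok ∘ splitAt (nE A)
      ; tgt-ok = tgt⊎-ok ∘ splitAt (nE A)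
      }

  module _ {A B S : Hyp} (f : A ⇒ S) (g : B ⇒ S) where
    private
      h : Fin (nV A + nV B) → Fin (nV S)
      h = [ fV f , fV g ]′ ∘ splitAt (nV A)
      hE⊎ : Fin (nE A) ⊎ Fin (nE B) → Fin (nE S)
      hE⊎ = [ fE f , fE g ]′
      pV⊎ : ∀ x → labV S ([ fV f , fV g ]′ x) ≡ [ labV A , labV B ]′ x
      pV⊎ (inj₁ x) = presV f x
      pV⊎ (inj₂ x) = presV g x
      pE⊎ : ∀ e → labE S (hE⊎ e) ≡ [ labE A , labE B ]′ e
      pE⊎ (inj₁ e) = presE f e
      pE⊎ (inj₂ e) = presE g e
      hl : ∀ xs → map h (map (_↑ˡ nV B) xs) ≡ map (fV f) xs
      hl xs = trans (sym (map-∘ xs))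
                (map-cong (λ x → cong [ fV f , fV g ]′ (splitAt-↑ˡ (nV A) x (nV B))) xs)
      hr : ∀ xs → map h (map (nV A ↑ʳ_) xs) ≡ map (fV g) xs
      hr xs = trans (sym (map-∘ xs))
                (map-cong (λ x → cong [ fV f , fV g ]′ (splitAt-↑ʳ (nV A) (nV B) x)) xs)
      pS⊎ : ∀ e → src S (hE⊎ e) ≡
              map h ([ (λ e → map (_↑ˡ nV B) (src A e)) , (λ e → map (nV A ↑ʳ_) (src B e)) ]′ e)
      pS⊎ (inj₁ e) = trans (presS f e) (sym (hl (src A e)))
      pS⊎ (inj₂ e) = trans (presS g e) (sym (hr (src B e)))
      pT⊎ : ∀ e → tgt S (hE⊎ e) ≡
              map h ([ (λ e → map (_↑ˡ nV B) (tgt A e)) , (λ e → map (nV A ↑ʳ_) (tgt B e)) ]′ e)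
      pT⊎ (inj₁ e) = trans (presT f e) (sym (hl (tgt A e)))
      pT⊎ (inj₂ e) = trans (presT g e) (sym (hr (tgt B e)))

    [_,_]ₕ : (A ⊕ B) ⇒ S
    [_,_]ₕ = record
      { fV = h
      ; fE = hE⊎ ∘ splitAt (nE A)
      ; presV = pV⊎ ∘ splitAt (nV A)
      ; presE = pE⊎ ∘ splitAt (nE A)
      ; presS = pS⊎ ∘ splitAt (nE A)
      ; presT = pT⊎ ∘ splitAt (nE A)
      }

  record Rule : Set where
    field
      {L K R} : Hyp
      l : K ⇒ L
      r : K ⇒ R

  record Step (ρ : Rule) {J S H : Hyp} (j : J ⇒ S) (jH : J ⇒ H) : Set where
    open Rule ρ
    field
      match : L ⇒ S
      D     : Hyp
      k     : K ⇒ D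
      c     : D ⇒ S
      d     : D ⇒ H
      m     : R ⇒ H
      jD    : J ⇒ D
      po₁   : IsPushout l k match c
      po₂   : IsPushout r k m d
      fac₁  : c ∘ₕ jD ≈ j
      fac₂  : d ∘ₕ jD ≈ jH

  record CriticalPair (ρ₁ ρ₂ : Rule) {J S H₁ H₂ : Hyp}
           (j : J ⇒ S) (j₁ : J ⇒ H₁) (j₂ : J ⇒ H₂) : Set where
    field
      step₁ : Step ρ₁ j j₁
      step₂ : Step ρ₂ j j₂
    open Step step₁ renaming (match to f₁; jD to jD₁; c to c₁)
    open Step step₂ renaming (match to f₂; jD to jD₂; c to c₂)
    field
      epi      : IsEpi [ f₁ , f₂ ]ₕ
      pullback : IsPullback jD₁ jD₂ c₁ c₂

-- Every hyperedge e of J is sent by j : J → S to the hyperedge s = j e, and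
-- since j factors as J → C₁ → S through the pushout complement of the first
-- step, s lies in the image of C₁ → S; symmetrically it lies in the image of
-- C₂ → S.  Two general facts about hypergraph homomorphisms then collide:
--
--   * in a pushout square over a discrete K, no hyperedge of the apex lies
--     in the image of both legs (edges are glued only along K);
--   * an epimorphism hits every hyperedge of its codomain (constructively:
--     a missed hyperedge is contradictory).
--
-- Hence s is missed by f₁ (pushout of step 1) and by f₂ (pushout of step 2),
-- so by [f₁ , f₂], contradicting that [f₁ , f₂] is epi.  Both facts are
-- proved by mapping into the "edge-doubled" hypergraph of S, which has two
-- copies of each hyperedge and hence several homomorphisms out of S that
-- agree on all vertices but separate chosen hyperedges.

module Submission where

open import Defs
open import Data.Nat using (ℕ; zero; suc; _+_)
open import Data.Fin using (Fin; splitAt; _↑ˡ_; _↑ʳ_; _≟_) renaming (zero to fzero)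
open import Data.Fin.Properties using (splitAt-↑ˡ; splitAt-↑ʳ)
open import Data.List.Properties using (map-id)
open import Data.Sum using (inj₁; inj₂; [_,_]′)
open import Data.Product using (Σ; _×_; _,_; proj₁; proj₂)
open import Data.Empty using (⊥; ⊥-elim)
open import Function using (_∘_; id)
open import Relation.Nullary using (¬_; yes; no)
open import Relation.Binary.PropositionalEquality
  using (_≡_; _≢_; refl; sym; trans; cong; module ≡-Reasoning)

Fin-zero-empty : ∀ {n} → n ≡ 0 → ¬ Fin n
Fin-zero-empty refl ()

Fin-empty : ∀ n → ¬ Fin n → n ≡ 0
Fin-empty zero    _     = refl
Fin-empty (suc n) noFin = ⊥-elim (noFin fzero)

↑ˡ≢↑ʳ : ∀ m n (x : Fin m) (y : Fin n) → x ↑ˡ n ≢ m ↑ʳ y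
↑ˡ≢↑ʳ m n x y eq
  with trans (sym (splitAt-↑ˡ m x n)) (trans (cong (splitAt m) eq) (splitAt-↑ʳ m n y))
... | ()

fold : ∀ n → Fin (n + n) → Fin n
fold n = [ id , id ]′ ∘ splitAt n

fold-↑ˡ : ∀ n x → fold n (x ↑ˡ n) ≡ x
fold-↑ˡ n x = cong [ id , id ]′ (splitAt-↑ˡ n x n)

fold-↑ʳ : ∀ n x → fold n (n ↑ʳ x) ≡ x
fold-↑ʳ n x = cong [ id , id ]′ (splitAt-↑ʳ n n x)

module _ {nC : ℕ} (Sig : Signature nC) where
  open HypCat Sig

  Doubled : Hyp → Hyp
  Doubled S = record
    { nV = nV S ; nE = nE S + nE S ; labV = labV S
    ; labE = labE S ∘ fold (nE S)
    ; src = src S ∘ fold (nE S) ; tgt = tgt S ∘ fold (nE S)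
    ; src-ok = src-ok S ∘ fold (nE S) ; tgt-ok = tgt-ok S ∘ fold (nE S) }

  choose : ∀ S (σ : Fin (nE S) → Fin (nE S + nE S)) →
           (∀ e → fold (nE S) (σ e) ≡ e) → S ⇒ Doubled S
  choose S σ section = record
    { fV = id ; fE = σ
    ; presV = λ _ → refl
    ; presE = λ e → cong (labE S) (section e)
    ; presS = λ e → trans (cong (src S) (section e)) (sym (map-id (src S e)))
    ; presT = λ e → trans (cong (tgt S) (section e)) (sym (map-id (tgt S e))) }

  left right : ∀ S → S ⇒ Doubled S
  left  S = choose S (_↑ˡ nE S) (fold-↑ˡ (nE S))
  right S = choose S (nE S ↑ʳ_) (fold-↑ʳ (nE S))

  module Flip (S : Hyp) (s : Fin (nE S)) where
    n : ℕ
    n = nE S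

    σ : Fin n → Fin (n + n)
    σ e with e ≟ s
    ... | yes _ = n ↑ʳ e
    ... | no  _ = e ↑ˡ n

    section : ∀ e → fold n (σ e) ≡ e
    section e with e ≟ s
    ... | yes _ = fold-↑ʳ n e
    ... | no  _ = fold-↑ˡ n e

    flip : S ⇒ Doubled S
    flip = choose S σ section

    flip-at : fE flip s ≡ n ↑ʳ s
    flip-at with s ≟ s
    ... | yes _  = refl
    ... | no s≢s = ⊥-elim (s≢s refl)

    flip-away : ∀ t → t ≢ s → fE (left S) t ≡ fE flip t
    flip-away t t≢s with t ≟ s
    ... | yes t≡s = ⊥-elim (t≢s t≡s)
    ... | no  _   = refl

  -- In a pushout over an edgeless K, the two legs have disjoint edge images:
  -- left ∘ p and right ∘ q agree on K, so they factor through the apex, and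
  -- a shared hyperedge would then be equal to both of its two copies.
  pushout-edges-disjoint :
    ∀ {K L D S} (a : K ⇒ L) (b : K ⇒ D) (p : L ⇒ S) (q : D ⇒ S) →
    Discrete K → IsPushout a b p q → ∀ x y → fE p x ≢ fE q y
  pushout-edges-disjoint {S = S} a b p q edgeless (commutes , universal) x y px≡qy =
    ↑ˡ≢↑ʳ (nE S) (nE S) (fE p x) (fE q y) (begin
      fE (left S) (fE p x)   ≡⟨ sym (proj₂ u∘p≈left∘p x) ⟩
      fE u (fE p x)          ≡⟨ cong (fE u) px≡qy ⟩
      fE u (fE q y)          ≡⟨ proj₂ u∘q≈right∘q y ⟩
      fE (right S) (fE q y)  ∎)
    where
      open ≡-Reasoning

      noEdge : ∀ e → fE (left S ∘ₕ p ∘ₕ a) e ≡ fE (right S ∘ₕ q ∘ₕ b) e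
      noEdge e = ⊥-elim (Fin-zero-empty edgeless e)

      factor : Σ (S ⇒ Doubled S) λ u → (u ∘ₕ p ≈ left S ∘ₕ p) × (u ∘ₕ q ≈ right S ∘ₕ q) ×
                 (∀ u' → u' ∘ₕ p ≈ left S ∘ₕ p → u' ∘ₕ q ≈ right S ∘ₕ q → u' ≈ u)
      factor = universal (left S ∘ₕ p) (right S ∘ₕ q) (proj₁ commutes , noEdge)

      u : S ⇒ Doubled S
      u = proj₁ factor

      u∘p≈left∘p : u ∘ₕ p ≈ left S ∘ₕ p
      u∘p≈left∘p = proj₁ (proj₂ factor)

      u∘q≈right∘q : u ∘ₕ q ≈ right S ∘ₕ q
      u∘q≈right∘q = proj₁ (proj₂ (proj₂ factor))

  -- An epimorphism misses no hyperedge: if h missed s, then left and the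
  -- homomorphism flipping s would agree after h, hence be equal, but they
  -- differ at s.
  epi-edge-dense : ∀ {A S} (h : A ⇒ S) → IsEpi h →
                   ∀ s → ¬ (∀ a → fE h a ≢ s)
  epi-edge-dense {S = S} h epi s missed =
    ↑ˡ≢↑ʳ (nE S) (nE S) s s (trans (proj₂ left≈flip s) flip-at)
    where
      open Flip S s
      left≈flip : left S ≈ flip
      left≈flip = epi (left S) flip ((λ _ → refl) , λ a → flip-away (fE h a) (missed a))

  copair-epi-edge-cover : ∀ {A B S} (f : A ⇒ S) (g : B ⇒ S) → IsEpi [ f , g ]ₕ →
                          ∀ s → (∀ x → fE f x ≢ s) → (∀ y → fE g y ≢ s) → ⊥
  copair-epi-edge-cover {A} f g epi s missedF missedG =
    epi-edge-dense [ f , g ]ₕ epi s missed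
    where
      missed : ∀ z → fE [ f , g ]ₕ z ≢ s
      missed z with splitAt (nE A) z
      ... | inj₁ x = missedF x
      ... | inj₂ y = missedG y

  step-interface-avoids-match :
    ∀ {ρ J S H} {j : J ⇒ S} {jH : J ⇒ H} → Discrete (Rule.K ρ) → (step : Step ρ j jH) →
    ∀ e x → fE (Step.match step) x ≢ fE j e
  step-interface-avoids-match {ρ} edgeless step e x fx≡je =
    pushout-edges-disjoint (Rule.l ρ) k match c edgeless po₁ x (fE jD e)
      (trans fx≡je (sym (proj₂ fac₁ e)))
    where open Step step

lemma26 : ∀ {nC : ℕ} (Sig : Signature nC) →
    let open HypCat Sig in
    (ρ₁ ρ₂ : Rule) {J S H₁ H₂ : Hyp}
    (j : J ⇒ S) (j₁ : J ⇒ H₁) (j₂ : J ⇒ H₂) →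
    CriticalPair ρ₁ ρ₂ j j₁ j₂ →
    Discrete (Rule.K ρ₁) → Discrete (Rule.K ρ₂) →
    Discrete J
lemma26 Sig ρ₁ ρ₂ {J} j j₁ j₂ cp edgeless₁ edgeless₂ =
  Fin-empty (nE J) λ e →
    copair-epi-edge-cover Sig (Step.match step₁) (Step.match step₂) epi (fE j e)
      (step-interface-avoids-match Sig edgeless₁ step₁ e)
      (step-interface-avoids-match Sig edgeless₂ step₂ e)
  where
    open HypCat Sig
    open CriticalPair cp using (step₁; step₂; epi)
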